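{- For all ordinals $\alpha<\varepsilon_0$ and natural numbers $n,x,m$: if $\alpha\searrow_n^x0$ and $m\leq n$, then $\alpha\searrow_n^x\{\alpha\}(m)$.
   Context: Fundamental sequences: $\{0\}(n)=0$, $\{\alpha+1\}(n)=\alpha$; for limit $\alpha=\gamma+\omega^{\delta}$ (Cantor normal form, $\delta>0$), $\{\alpha\}(n)=\gamma+\omega^{\delta'}\cdot(n+1)$ if $\delta=\delta'+1$, and $\{\alpha\}(n)=\gamma+\omega^{\{\delta\}(n)}$ if $\delta$ is a limit. $\mathrm{fund}(\alpha,n,0)=\alpha$, $\mathrm{fund}(\alpha,n,x+1)=\{\mathrm{fund}(\alpha,n,x)\}(n)$; $\alpha\searrow_n^x\beta$ means $\exists y\leq x\;\mathrm{fund}(\alpha,n,y)=\beta$. -}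

module Defs where

open import Data.Nat using (ℕ; zero; suc; _≤_)
open import Data.Bool using (Bool; true; false; if_then_else_)
open import Data.Product using (∃; _×_)
open import Data.Sum using (_⊎_)
open import Relation.Binary.PropositionalEquality using (_≡_)

-- Ordinals below ε₀ in Cantor normal form:
--   𝟎 is 0,  ω^ a + b  is  ω^a + b.
data Ord : Set where
  𝟎    : Ord
  ω^_+_ : Ord → Ord → Ord

data _<ₒ_ : Ord → Ord → Set where
  <𝟎  : ∀ {a b} → 𝟎 <ₒ (ω^ a + b)
  <ω  : ∀ {a b c d} → a <ₒ c → (ω^ a + b) <ₒ (ω^ c + d)
  <+  : ∀ {a b d} → b <ₒ d → (ω^ a + b) <ₒ (ω^ a + d)

data _≤lead_ : Ord → Ord → Set where
  lead𝟎 : ∀ {a} → 𝟎 ≤lead a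
  leadω : ∀ {a c d} → (c <ₒ a ⊎ c ≡ a) → (ω^ c + d) ≤lead a

data IsNF : Ord → Set where
  nf𝟎 : IsNF 𝟎
  nfω : ∀ {a b} → IsNF a → IsNF b → b ≤lead a → IsNF (ω^ a + b)

isSucc : Ord → Bool
isSucc 𝟎 = false
isSucc (ω^ 𝟎 + 𝟎) = true
isSucc (ω^ (ω^ _ + _) + 𝟎) = false
isSucc (ω^ a + (ω^ c + d)) = isSucc (ω^ c + d)

ωmul : Ord → ℕ → Ord
ωmul a zero = 𝟎
ωmul a (suc k) = ω^ a + ωmul a k

-- Fundamental sequence {α}(n).
--  {0}(n) = 0; {γ+1}(n) = γ;
--  {γ+ω^(δ'+1)}(n) = γ + ω^δ'·(n+1);  {γ+ω^δ}(n) = γ + ω^{δ}(n) for δ limit.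
-- For δ a successor, {δ}(n) = δ', so δ' is computed as fs δ n.
fs : Ord → ℕ → Ord
fs 𝟎 n = 𝟎
fs (ω^ 𝟎 + 𝟎) n = 𝟎
fs (ω^ (ω^ c + d) + 𝟎) n =
  if isSucc (ω^ c + d)
  then ωmul (fs (ω^ c + d) n) (suc n)
  else (ω^ fs (ω^ c + d) n + 𝟎)
fs (ω^ a + (ω^ c + d)) n = ω^ a + fs (ω^ c + d) n

fund : Ord → ℕ → ℕ → Ord
fund α n zero = α
fund α n (suc x) = fs (fund α n x) n

_↘[_,_]_ : Ord → ℕ → ℕ → Ord → Set
α ↘[ n , x ] β = ∃ λ y → y ≤ x × fund α n y ≡ β

module Submission where

open import Defs
open import Data.Nat using (ℕ; zero; suc; _≤_; z≤n; s≤s; _≤?_)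
open import Data.Nat.Properties using (≤-trans; <⇒≤; ≰⇒>; m≤n⇒m<n∨m≡n)
open import Data.Bool using (true; false)
open import Data.Product using (∃; _,_)
open import Data.Sum using (inj₁; inj₂)
open import Relation.Nullary using (yes; no)
open import Relation.Binary.PropositionalEquality using (_≡_; refl; sym; trans; cong)
open import Relation.Binary.Construct.Closure.ReflexiveTransitive using (Star; ε; _◅_; _◅◅_)

-- Every term reaches 0 under every fundamental sequence index n, and a
-- term ω^a·(k+1) shrinks to ω^a·(m+1) by n-steps.  From these, {α}(n)
-- reaches {α}(m) by n-steps whenever m ≤ n (induction on α).  So {α}(m)
-- lies on the n-descent of α; if it lies beyond step x, then the descent
-- has already hit 0 (a fixed point of {·}(n)) by then, forcing {α}(m) = 0.

infix 4 _↠⟨_⟩_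

_↠⟨_⟩_ : Ord → ℕ → Ord → Set
a ↠⟨ n ⟩ b = Star (λ c d → fs c n ≡ d) a b

𝟎-↠-only-𝟎 : ∀ {n b} → 𝟎 ↠⟨ n ⟩ b → b ≡ 𝟎
𝟎-↠-only-𝟎 ε = refl
𝟎-↠-only-𝟎 (refl ◅ d) = 𝟎-↠-only-𝟎 d

ω^+-↠ : ∀ {n a b b′} → b ↠⟨ n ⟩ b′ → ω^ a + b ↠⟨ n ⟩ ω^ a + b′
ω^+-↠ ε = ε
ω^+-↠ {b = 𝟎} (refl ◅ d) rewrite 𝟎-↠-only-𝟎 d = ε
ω^+-↠ {a = 𝟎} {b = ω^ _ + _} (refl ◅ d) = refl ◅ ω^+-↠ d
ω^+-↠ {a = ω^ _ + _} {b = ω^ _ + _} (refl ◅ d) = refl ◅ ω^+-↠ d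

ωmul-↠-𝟎 : ∀ {n a} → ω^ a + 𝟎 ↠⟨ n ⟩ 𝟎 → ∀ k → ωmul a k ↠⟨ n ⟩ 𝟎
ωmul-↠-𝟎 t zero = ε
ωmul-↠-𝟎 t (suc k) = ω^+-↠ (ωmul-↠-𝟎 t k) ◅◅ t

ω^-↠-𝟎 : ∀ {n a} → a ↠⟨ n ⟩ 𝟎 → ω^ a + 𝟎 ↠⟨ n ⟩ 𝟎
ω^-↠-𝟎 {a = 𝟎} _ = refl ◅ ε
ω^-↠-𝟎 {n} {a = ω^ c + e} (refl ◅ d) = refl ◅ from-fs-exponent (ω^-↠-𝟎 d)
  where
  from-fs-exponent : ω^ fs (ω^ c + e) n + 𝟎 ↠⟨ n ⟩ 𝟎 →
    fs (ω^ (ω^ c + e) + 𝟎) n ↠⟨ n ⟩ 𝟎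
  from-fs-exponent t with isSucc (ω^ c + e)
  ... | true = ωmul-↠-𝟎 t (suc n)
  ... | false = t

↠-𝟎 : ∀ a n → a ↠⟨ n ⟩ 𝟎
↠-𝟎 𝟎 n = ε
↠-𝟎 (ω^ a + b) n = ω^+-↠ (↠-𝟎 b n) ◅◅ ω^-↠-𝟎 (↠-𝟎 a n)

ωmul-↠ : ∀ {n a m k} → m ≤ k → ωmul a (suc k) ↠⟨ n ⟩ ωmul a (suc m)
ωmul-↠ {n} {a} {k = k} z≤n = ω^+-↠ (↠-𝟎 (ωmul a k) n)
ωmul-↠ (s≤s m≤k) = ω^+-↠ (ωmul-↠ m≤k)

fs-ω^-↠-ω^-fs : ∀ n c e →
  fs (ω^ (ω^ c + e) + 𝟎) n ↠⟨ n ⟩ ω^ fs (ω^ c + e) n + 𝟎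
fs-ω^-↠-ω^-fs n c e with isSucc (ω^ c + e)
... | true = ω^+-↠ (↠-𝟎 _ n)
... | false = ε

ω^-↠ : ∀ {n a b} → a ↠⟨ n ⟩ b → ω^ a + 𝟎 ↠⟨ n ⟩ ω^ b + 𝟎
ω^-↠ ε = ε
ω^-↠ {a = 𝟎} (refl ◅ d) rewrite 𝟎-↠-only-𝟎 d = ε
ω^-↠ {n} {a = ω^ c + e} (refl ◅ d) = (refl ◅ fs-ω^-↠-ω^-fs n c e) ◅◅ ω^-↠ d

fs-isSucc-indep : ∀ a n m → isSucc a ≡ true → fs a n ≡ fs a m
fs-isSucc-indep (ω^ 𝟎 + 𝟎) n m eq = refl
fs-isSucc-indep (ω^ 𝟎 + (ω^ c + e)) n m eq =
  cong (ω^ 𝟎 +_) (fs-isSucc-indep (ω^ c + e) n m eq)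
fs-isSucc-indep (ω^ (ω^ p + q) + (ω^ c + e)) n m eq =
  cong (ω^ (ω^ p + q) +_) (fs-isSucc-indep (ω^ c + e) n m eq)

ω^-fs-↠ : ∀ {n m} c e → m ≤ n →
  fs (ω^ c + e) n ↠⟨ n ⟩ fs (ω^ c + e) m →
  fs (ω^ (ω^ c + e) + 𝟎) n ↠⟨ n ⟩ fs (ω^ (ω^ c + e) + 𝟎) m
ω^-fs-↠ {n} {m} c e m≤n fs↠ with isSucc (ω^ c + e) in succ
... | true rewrite fs-isSucc-indep (ω^ c + e) n m succ = ωmul-↠ m≤n
... | false = ω^-↠ fs↠

fs-↠ : ∀ α {n m} → m ≤ n → fs α n ↠⟨ n ⟩ fs α m
fs-↠ 𝟎 m≤n = ε
fs-↠ (ω^ 𝟎 + 𝟎) m≤n = ε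
fs-↠ (ω^ (ω^ c + e) + 𝟎) m≤n = ω^-fs-↠ c e m≤n (fs-↠ (ω^ c + e) m≤n)
fs-↠ (ω^ 𝟎 + (ω^ c + e)) m≤n = ω^+-↠ (fs-↠ (ω^ c + e) m≤n)
fs-↠ (ω^ (ω^ p + q) + (ω^ c + e)) m≤n = ω^+-↠ (fs-↠ (ω^ c + e) m≤n)

fund-suc : ∀ a n k → fund a n (suc k) ≡ fund (fs a n) n k
fund-suc a n zero = refl
fund-suc a n (suc k) = cong (λ b → fs b n) (fund-suc a n k)

↠⇒fund : ∀ {n a b} → a ↠⟨ n ⟩ b → ∃ λ k → fund a n k ≡ b
↠⇒fund ε = zero , refl
↠⇒fund {n} {a} (refl ◅ d) with ↠⇒fund d
... | k , p = suc k , trans (fund-suc a n k) p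

fund-𝟎-absorbing : ∀ {a n y} k → fund a n y ≡ 𝟎 → y ≤ k → fund a n k ≡ 𝟎
fund-𝟎-absorbing zero p z≤n = p
fund-𝟎-absorbing {n = n} (suc k) p y≤k with m≤n⇒m<n∨m≡n y≤k
... | inj₁ (s≤s y≤k′) = cong (λ b → fs b n) (fund-𝟎-absorbing k p y≤k′)
... | inj₂ refl = p

↘𝟎-↠ : ∀ {α β n x} → α ↘[ n , x ] 𝟎 → α ↠⟨ n ⟩ β → α ↘[ n , x ] β
↘𝟎-↠ {x = x} (y , y≤x , α↘𝟎) α↠β with ↠⇒fund α↠β
... | k , refl with k ≤? x
...   | yes k≤x = k , k≤x , refl
...   | no k≰x = y , y≤x , trans α↘𝟎 (sym (fund-𝟎-absorbing k α↘𝟎 y≤k))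
  where
  y≤k : y ≤ k
  y≤k = ≤-trans y≤x (<⇒≤ (≰⇒> k≰x))

lemma4p6 : (α : Ord) → IsNF α → (n x m : ℕ) →
    α ↘[ n , x ] 𝟎 → m ≤ n → α ↘[ n , x ] fs α m
lemma4p6 α _ n x m α↘𝟎 m≤n = ↘𝟎-↠ α↘𝟎 (refl ◅ fs-↠ α m≤n)
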